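{- Let $q$ be an odd prime power, $\omega$ a non-square in $\mathbb F_q$, and $\epsilon\in\mathbb F_{q^2}$ with $\epsilon^2=\omega$; write each $z\in\mathbb F_{q^2}$ as $z=z_1+\epsilon z_2$ with $z_1,z_2\in\mathbb F_q$. Let $\mathcal C$ be the irreducible conic $aX^2+bXY+cXZ+dYZ+eZ^2=0$ of $\mathrm{PG}(2,q^2)$ with $a,b,c,d,e\in\mathbb F_{q^2}$, $b\neq 0$, $b_2\neq0$ or $d_2\neq 0$, and $b_1d_2=d_1b_2$. Then the line of $\mathrm{PG}(2,q)$ with equation $b_1X+d_1Z=0$ is the tangent line to $\mathcal C$ at $(0:1:0)$; in particular it contains exactly $q$ points external to $\mathcal C$.
   Context: A point not on $\mathcal C$ is external if it lies on two tangent lines to $\mathcal C$. -}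

module Defs where

open import Data.Product using (Σ; _×_; _,_; proj₁; proj₂)
open import Data.Sum using (_⊎_)
open import Data.List using (List; length)
open import Data.List.Membership.Propositional using (_∈_)
open import Data.List.Relation.Unary.Unique.Propositional using (Unique)
open import Data.List.Relation.Unary.All using (All)
open import Data.List.Relation.Unary.Any using (Any)
open import Data.List.Relation.Unary.AllPairs using (AllPairs)
open import Data.Nat using (ℕ)
open import Relation.Nullary using (¬_)
open import Relation.Binary.PropositionalEquality using (_≡_)
open import Relation.Binary.Definitions using (DecidableEquality)
open import Algebra.Structures using (IsCommutativeRing)

record FiniteOddField : Set₁ where
  infixl 6 _+_
  infixl 7 _*_
  field
    K        : Set
    _+_ _*_  : K → K → K
    -_       : K → K
    0# 1#    : K
    isCommutativeRing : IsCommutativeRing _≡_ _+_ _*_ -_ 0# 1#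
    _≟_      : DecidableEquality K
    1≢0      : ¬ (1# ≡ 0#)
    inverse  : ∀ x → ¬ (x ≡ 0#) → Σ K λ y → x * y ≡ 1#
    elements : List K
    complete : ∀ x → x ∈ elements
    unique   : Unique elements
    char≢2   : ¬ (1# + 1# ≡ 0#)

  q : ℕ
  q = length elements

  NonSquare : K → Set
  NonSquare ω = ∀ x → ¬ (x * x ≡ ω)

-- F_{q^2} = F_q(ε), ε² = ω, elements z = z₁ + ε z₂ represented as pairs (z₁ , z₂).
module Ext (F : FiniteOddField) (ω : FiniteOddField.K F) where
  open FiniteOddField F

  K₂ : Set
  K₂ = K × K

  infixl 6 _⊕_
  infixl 7 _⊗_

  _⊕_ : K₂ → K₂ → K₂
  (x₁ , x₂) ⊕ (y₁ , y₂) = (x₁ + y₁ , x₂ + y₂)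

  _⊗_ : K₂ → K₂ → K₂
  (x₁ , x₂) ⊗ (y₁ , y₂) = (x₁ * y₁ + ω * (x₂ * y₂) , x₁ * y₂ + x₂ * y₁)

  0₂ 1₂ ε : K₂
  0₂ = (0# , 0#)
  1₂ = (1# , 0#)
  ε  = (0# , 1#)

  ι : K → K₂
  ι x = (x , 0#)

  Triple : Set
  Triple = K₂ × K₂ × K₂

  NonZero : Triple → Set
  NonZero v = ¬ (v ≡ (0₂ , 0₂ , 0₂))

  scale : K₂ → Triple → Triple
  scale t (x , y , z) = (t ⊗ x , t ⊗ y , t ⊗ z)

  Proportional : Triple → Triple → Set
  Proportional u v = Σ K₂ λ t → ¬ (t ≡ 0₂) × u ≡ scale t v

  OnLine : Triple → Triple → Set
  OnLine (u , v , w) (x , y , z) = u ⊗ x ⊕ v ⊗ y ⊕ w ⊗ z ≡ 0₂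

  module Conic (a b c d e : K₂) where

    form : Triple → K₂
    form (x , y , z) = a ⊗ x ⊗ x ⊕ b ⊗ x ⊗ y ⊕ c ⊗ x ⊗ z ⊕ d ⊗ y ⊗ z ⊕ e ⊗ z ⊗ z

    OnC : Triple → Set
    OnC p = form p ≡ 0₂

    -- irreducible (non-degenerate): the determinant of the associated
    -- symmetric matrix, -(a d² + e b² - b c d)/4, is nonzero
    Irreducible : Set
    Irreducible = ¬ (a ⊗ d ⊗ d ⊕ e ⊗ b ⊗ b ⊕ (ι (- 1#)) ⊗ b ⊗ c ⊗ d ≡ 0₂)

    TangentAt : Triple → Triple → Set
    TangentAt l P = NonZero l × NonZero P × OnC P × OnLine l P
                  × (∀ Q → NonZero Q → OnC Q → OnLine l Q → Proportional Q P)

    Tangent : Triple → Set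
    Tangent l = Σ Triple λ P → TangentAt l P

    External : Triple → Set
    External p = NonZero p × ¬ OnC p ×
      Σ Triple λ l → Σ Triple λ m →
        Tangent l × Tangent m × ¬ Proportional l m × OnLine l p × OnLine m p

  embed : K × K × K → Triple
  embed (x , y , z) = (ι x , ι y , ι z)

-- Over F_{q²} the conic is nondegenerate, and a tangent meets it only at its point of contact:
-- if x ∈ C lies on the tangent at p ∈ C, the tangents at p and at x both pass through p and x,
-- so by the Lagrange identity their cross product is annihilated by every coordinate of p ⨯ x;
-- the polarity maps that cross product to 2Δ (p ⨯ x), whence p ⨯ x = 0. Since b₁d₂ = d₁b₂, the
-- tangent bX + dZ = 0 at e₂ = (0:1:0) is the line L : b₁X + d₁Z = 0 of PG(2,q). Its other points
-- are (-d₁ : y : b₁) with y ∈ F_q; none of them is on C, and each lies on a second tangent, the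
-- one at the second intersection of its polar with C.
module Submission where

open import Algebra using (CommutativeRing; RawRing)
open import Algebra.Structures using (IsCommutativeRing)
open import Data.Empty using (⊥-elim)
open import Data.Integer as ℤ using (ℤ; -[1+_]; _◃_)
import Data.Integer.Properties as ℤ
open import Data.List using (List; length; map)
open import Data.List.Properties using (length-map)
open import Data.List.Relation.Unary.All as All using (All)
import Data.List.Relation.Unary.All.Properties as All
open import Data.List.Relation.Unary.AllPairs as AllPairs using (AllPairs)
import Data.List.Relation.Unary.AllPairs.Properties as AllPairs
open import Data.List.Relation.Unary.Any as Any using (Any)
import Data.List.Relation.Unary.Any.Properties as Any
open import Data.Maybe using (Maybe; just; nothing)
open import Data.Nat as ℕ using (ℕ; zero; suc)
import Data.Nat.Properties as ℕ
open import Data.Product using (Σ; _×_; _,_; proj₁; proj₂)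
open import Data.Product.Properties using (≡-dec)
import Data.Sign as Sign
open import Data.Sum using (_⊎_)
open import Function using (id)
open import Level using (0ℓ)
open import Relation.Binary.Definitions using (DecidableEquality)
open import Relation.Binary.PropositionalEquality as ≡
  using (_≡_; _≢_; refl; sym; trans; cong; cong₂; module ≡-Reasoning)
open import Relation.Nullary using (¬_; yes; no)

open import Defs

module IntegerRingSolver {c ℓ} (R : CommutativeRing c ℓ) where
  open CommutativeRing R renaming (refl to ≈-refl; sym to ≈-sym; trans to ≈-trans)
  open import Algebra.Properties.Ring ring
    using (-0#≈0#; -‿distribˡ-*; -‿distribʳ-*; -‿involutive; -‿+-comm)
  open import Algebra.Properties.Semiring.Mult.TCOptimised semiring
    using (×-homo-+; ×1-homo-*; 1+×) renaming (_×_ to _×ₙ_)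
  open import Algebra.Solver.Ring.AlmostCommutativeRing
    using (AlmostCommutativeRing; fromCommutativeRing; _-Raw-AlmostCommutative⟶_)
  open import Relation.Binary.Reasoning.Setoid setoid

  ⟦_⟧ℤ : ℤ → Carrier
  ⟦ ℤ.+ n ⟧ℤ      = n ×ₙ 1#
  ⟦ -[1+ n ] ⟧ℤ = - (suc n ×ₙ 1#)

  private
    +-interchange : ∀ w x y z → (w + x) + (y + z) ≈ (w + y) + (x + z)
    +-interchange w x y z = begin
      (w + x) + (y + z) ≈⟨ +-assoc w x (y + z) ⟩
      w + (x + (y + z)) ≈⟨ +-congˡ (+-assoc x y z) ⟨
      w + ((x + y) + z) ≈⟨ +-congˡ (+-congʳ (+-comm x y)) ⟩
      w + ((y + x) + z) ≈⟨ +-congˡ (+-assoc y x z) ⟩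
      w + (y + (x + z)) ≈⟨ +-assoc w y (x + z) ⟨
      (w + y) + (x + z) ∎

  ⟦⊖⟧ : ∀ m n → ⟦ m ℤ.⊖ n ⟧ℤ ≈ m ×ₙ 1# + - (n ×ₙ 1#)
  ⟦⊖⟧ m       zero    = ≈-sym (≈-trans (+-congˡ -0#≈0#) (+-identityʳ _))
  ⟦⊖⟧ zero    (suc n) = ≈-sym (+-identityˡ _)
  ⟦⊖⟧ (suc m) (suc n) = begin
    ⟦ suc m ℤ.⊖ suc n ⟧ℤ                 ≡⟨ cong ⟦_⟧ℤ (ℤ.[1+m]⊖[1+n]≡m⊖n m n) ⟩
    ⟦ m ℤ.⊖ n ⟧ℤ                         ≈⟨ ⟦⊖⟧ m n ⟩
    m ×ₙ 1# + - (n ×ₙ 1#)                  ≈⟨ +-identityˡ _ ⟨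
    0# + (m ×ₙ 1# + - (n ×ₙ 1#))           ≈⟨ +-congʳ (-‿inverseʳ 1#) ⟨
    (1# + - 1#) + (m ×ₙ 1# + - (n ×ₙ 1#))  ≈⟨ +-interchange 1# (- 1#) (m ×ₙ 1#) (- (n ×ₙ 1#)) ⟩
    (1# + m ×ₙ 1#) + (- 1# + - (n ×ₙ 1#))  ≈⟨ +-congˡ (-‿+-comm 1# (n ×ₙ 1#)) ⟩
    (1# + m ×ₙ 1#) + - (1# + n ×ₙ 1#)      ≈⟨ +-cong (1+× m 1#) (-‿cong (1+× n 1#)) ⟨
    suc m ×ₙ 1# + - (suc n ×ₙ 1#)          ∎

  ⟦+⟧ : ∀ i j → ⟦ i ℤ.+ j ⟧ℤ ≈ ⟦ i ⟧ℤ + ⟦ j ⟧ℤ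
  ⟦+⟧ (ℤ.+ m)    (ℤ.+ n)    = ×-homo-+ 1# m n
  ⟦+⟧ (ℤ.+ m)    -[1+ n ] = ⟦⊖⟧ m (suc n)
  ⟦+⟧ -[1+ m ] (ℤ.+ n)    = ≈-trans (⟦⊖⟧ n (suc m)) (+-comm _ _)
  ⟦+⟧ -[1+ m ] -[1+ n ] = begin
    - (suc (suc (m ℕ.+ n)) ×ₙ 1#)        ≡⟨ cong (λ k → - (suc k ×ₙ 1#)) (ℕ.+-suc m n) ⟨
    - ((suc m ℕ.+ suc n) ×ₙ 1#)          ≈⟨ -‿cong (×-homo-+ 1# (suc m) (suc n)) ⟩
    - (suc m ×ₙ 1# + suc n ×ₙ 1#)         ≈⟨ -‿+-comm _ _ ⟨
    - (suc m ×ₙ 1#) + - (suc n ×ₙ 1#)     ∎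

  ⟦+◃⟧ : ∀ k → ⟦ Sign.+ ◃ k ⟧ℤ ≈ k ×ₙ 1#
  ⟦+◃⟧ zero    = ≈-refl
  ⟦+◃⟧ (suc k) = ≈-refl

  ⟦-◃⟧ : ∀ k → ⟦ Sign.- ◃ k ⟧ℤ ≈ - (k ×ₙ 1#)
  ⟦-◃⟧ zero    = ≈-sym -0#≈0#
  ⟦-◃⟧ (suc k) = ≈-refl

  ⟦*⟧ : ∀ i j → ⟦ i ℤ.* j ⟧ℤ ≈ ⟦ i ⟧ℤ * ⟦ j ⟧ℤ
  ⟦*⟧ (ℤ.+ m)    (ℤ.+ n)    = ≈-trans (⟦+◃⟧ (m ℕ.* n)) (×1-homo-* m n)
  ⟦*⟧ (ℤ.+ m)    -[1+ n ] = begin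
    ⟦ Sign.- ◃ (m ℕ.* suc n) ⟧ℤ  ≈⟨ ⟦-◃⟧ (m ℕ.* suc n) ⟩
    - ((m ℕ.* suc n) ×ₙ 1#)       ≈⟨ -‿cong (×1-homo-* m (suc n)) ⟩
    - (m ×ₙ 1# * suc n ×ₙ 1#)      ≈⟨ -‿distribʳ-* _ _ ⟩
    m ×ₙ 1# * - (suc n ×ₙ 1#)      ∎
  ⟦*⟧ -[1+ m ] (ℤ.+ n)    = begin
    ⟦ Sign.- ◃ (suc m ℕ.* n) ⟧ℤ  ≈⟨ ⟦-◃⟧ (suc m ℕ.* n) ⟩
    - ((suc m ℕ.* n) ×ₙ 1#)       ≈⟨ -‿cong (×1-homo-* (suc m) n) ⟩
    - (suc m ×ₙ 1# * n ×ₙ 1#)      ≈⟨ -‿distribˡ-* _ _ ⟩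
    - (suc m ×ₙ 1#) * n ×ₙ 1#      ∎
  ⟦*⟧ -[1+ m ] -[1+ n ] = begin
    (suc m ℕ.* suc n) ×ₙ 1#           ≈⟨ ×1-homo-* (suc m) (suc n) ⟩
    suc m ×ₙ 1# * suc n ×ₙ 1#          ≈⟨ -‿involutive _ ⟨
    - - (suc m ×ₙ 1# * suc n ×ₙ 1#)    ≈⟨ -‿cong (-‿distribʳ-* _ _) ⟩
    - (suc m ×ₙ 1# * - (suc n ×ₙ 1#))  ≈⟨ -‿distribˡ-* _ _ ⟩
    - (suc m ×ₙ 1#) * - (suc n ×ₙ 1#)  ∎

  ⟦-⟧ : ∀ i → ⟦ ℤ.- i ⟧ℤ ≈ - ⟦ i ⟧ℤ
  ⟦-⟧ (ℤ.+ zero)    = ≈-sym -0#≈0#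
  ⟦-⟧ (ℤ.+ suc n)   = ≈-refl
  ⟦-⟧ -[1+ n ]    = ≈-sym (-‿involutive _)

  ℤ-morphism : ℤ.+-*-rawRing -Raw-AlmostCommutative⟶ fromCommutativeRing R
  ℤ-morphism = record
    { ⟦_⟧ = ⟦_⟧ℤ ; +-homo = ⟦+⟧ ; *-homo = ⟦*⟧ ; -‿homo = ⟦-⟧ ; 0-homo = ≈-refl ; 1-homo = ≈-refl }

  ⟦≟⟧ : ∀ i j → Maybe (⟦ i ⟧ℤ ≈ ⟦ j ⟧ℤ)
  ⟦≟⟧ i j with i ℤ.≟ j
  ... | yes refl = just ≈-refl
  ... | no _       = nothing

  open import Algebra.Solver.Ring ℤ.+-*-rawRing (fromCommutativeRing R) ℤ-morphism ⟦≟⟧ public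

module Coordinates {c ℓ} (R : RawRing c ℓ) where
  open RawRing R

  Vector : Set c
  Vector = Carrier × Carrier × Carrier

  0⃗ e₁ e₂ e₃ : Vector
  0⃗ = (0# , 0# , 0#)
  e₁ = (1# , 0# , 0#)
  e₂ = (0# , 1# , 0#)
  e₃ = (0# , 0# , 1#)

  π₁ π₂ π₃ : Vector → Carrier
  π₁ (x , _ , _) = x
  π₂ (_ , y , _) = y
  π₃ (_ , _ , z) = z

  scale : Carrier → Vector → Vector
  scale t (x , y , z) = (t * x , t * y , t * z)

  infixl 6 _⊞_
  infixl 7 _∙_ _⨯_

  _⊞_ : Vector → Vector → Vector
  (u , v , w) ⊞ (x , y , z) = (u + x , v + y , w + z)

  _∙_ : Vector → Vector → Carrier
  (u , v , w) ∙ (x , y , z) = u * x + v * y + w * z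

  _⨯_ : Vector → Vector → Vector
  (u , v , w) ⨯ (x , y , z) = (v * z + - (w * y) , w * x + - (u * z) , u * y + - (v * x))

  module PlaneConic (a b c d e : Carrier) where

    form : Vector → Carrier
    form (x , y , z) = a * x * x + b * x * y + c * x * z + d * y * z + e * z * z

    polar : Vector → Vector
    polar (x , y , z) = ((a + a) * x + b * y + c * z , b * x + d * z , c * x + d * y + (e + e) * z)

    discriminant : Carrier
    discriminant = a * d * d + e * b * b + (- 1#) * b * c * d

    -- The points of the line n₁X + n₃Z = 0 other than e₂ are (-n₃ : y : n₁), and on them the
    -- form vanishes iff β n · y = a n₃² - c n₁ n₃ + e n₁²; multiplying the solution by β n gives
    -- the second intersection of that line with the conic.
    β : Vector → Carrier
    β (n₁ , _ , n₃) = b * n₃ + - (d * n₁)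

    secondIntersection : Vector → Vector
    secondIntersection n@(n₁ , _ , n₃) =
      (- (β n * n₃) , a * n₃ * n₃ + - (c * n₁ * n₃) + e * n₁ * n₁ , β n * n₁)

record OddCharacteristicField : Set₁ where
  infixl 6 _+_
  infixl 7 _*_
  field
    Carrier           : Set
    _+_ _*_           : Carrier → Carrier → Carrier
    -_                : Carrier → Carrier
    0# 1#             : Carrier
    isCommutativeRing : IsCommutativeRing _≡_ _+_ _*_ -_ 0# 1#
    _≟_               : DecidableEquality Carrier
    inverse           : ∀ x → x ≢ 0# → Σ Carrier λ y → x * y ≡ 1#
    char≢2            : 1# + 1# ≢ 0#

  commutativeRing : CommutativeRing 0ℓ 0ℓ
  commutativeRing = record { isCommutativeRing = isCommutativeRing }

oddCharacteristicField : FiniteOddField → OddCharacteristicField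
oddCharacteristicField F = record
  { Carrier = K ; _+_ = _+_ ; _*_ = _*_ ; -_ = -_ ; 0# = 0# ; 1# = 1#
  ; isCommutativeRing = isCommutativeRing ; _≟_ = _≟_ ; inverse = inverse ; char≢2 = char≢2 }
  where open FiniteOddField F

module FieldProperties (𝔽 : OddCharacteristicField) where
  open OddCharacteristicField 𝔽 public
  open CommutativeRing commutativeRing public
    using (rawRing; +-identityʳ; *-identityˡ; *-comm)
    renaming (zeroˡ to *-zeroˡ; zeroʳ to *-zeroʳ)
  open CommutativeRing commutativeRing using (ring)
  open import Algebra.Properties.Ring ring using (-‿involutive)
  open import Algebra.Properties.Ring ring public
    using () renaming (x∙y⁻¹≈ε⇒x≈y to x-y≡0⇒x≡y; -0#≈0# to -0#≡0#)
  open IntegerRingSolver commutativeRing using (con)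
  open IntegerRingSolver commutativeRing public using (Polynomial; solve; _:=_; _:+_; _:*_; :-_)
  open ≡-Reasoning

  0ᴾ 1ᴾ : ∀ {n} → Polynomial n
  0ᴾ = con (ℤ.+ 0)
  1ᴾ = con (ℤ.+ 1)

  1≢0 : 1# ≢ 0#
  1≢0 1≡0 = char≢2 (trans (cong₂ _+_ 1≡0 1≡0) (+-identityʳ 0#))

  *-cancelˡ : ∀ {x y z} → x ≢ 0# → x * y ≡ x * z → y ≡ z
  *-cancelˡ {x} {y} {z} x≢0 xy≡xz = begin
    y              ≡⟨ undo y ⟨
    x⁻¹ * (x * y)  ≡⟨ cong (x⁻¹ *_) xy≡xz ⟩
    x⁻¹ * (x * z)  ≡⟨ undo z ⟩
    z              ∎
    where
    x⁻¹ : Carrier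
    x⁻¹ = proj₁ (inverse x x≢0)
    undo : ∀ w → x⁻¹ * (x * w) ≡ w
    undo w = begin
      x⁻¹ * (x * w)  ≡⟨ solve 3 (λ x x⁻¹ w → x⁻¹ :* (x :* w) := x :* x⁻¹ :* w) refl x x⁻¹ w ⟩
      x * x⁻¹ * w    ≡⟨ cong (_* w) (proj₂ (inverse x x≢0)) ⟩
      1# * w         ≡⟨ *-identityˡ w ⟩
      w              ∎

  *≡0⇒≡0 : ∀ {x y} → x ≢ 0# → x * y ≡ 0# → y ≡ 0#
  *≡0⇒≡0 {x} x≢0 xy≡0 = *-cancelˡ x≢0 (trans xy≡0 (sym (*-zeroʳ x)))

  *≢0 : ∀ {x y} → x ≢ 0# → y ≢ 0# → x * y ≢ 0#
  *≢0 x≢0 y≢0 xy≡0 = y≢0 (*≡0⇒≡0 x≢0 xy≡0)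

  x*x≡0⇒x≡0 : ∀ {x} → x * x ≡ 0# → x ≡ 0#
  x*x≡0⇒x≡0 {x} xx≡0 with x ≟ 0#
  ... | yes x≡0 = x≡0
  ... | no  x≢0 = *≡0⇒≡0 x≢0 xx≡0

  z≡t*z⇒t≡1 : ∀ {t z} → z ≢ 0# → z ≡ t * z → t ≡ 1#
  z≡t*z⇒t≡1 {t} {z} z≢0 z≡tz = *-cancelˡ z≢0 (begin
    z * t   ≡⟨ *-comm z t ⟩
    t * z   ≡⟨ z≡tz ⟨
    z       ≡⟨ solve 1 (λ z → z := z :* 1ᴾ) refl z ⟩
    z * 1#  ∎)

  -x≡0⇒x≡0 : ∀ {x} → - x ≡ 0# → x ≡ 0#
  -x≡0⇒x≡0 {x} -x≡0 = trans (sym (-‿involutive x)) (trans (cong -_ -x≡0) -0#≡0#)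

module Geometry (𝔽 : OddCharacteristicField) where
  open FieldProperties 𝔽
  open Coordinates rawRing public
  open ≡-Reasoning

  -- The same definitions over the ring solver's syntax, so that identities between them can be
  -- handed to the solver.
  private
    polynomials : ℕ → RawRing 0ℓ 0ℓ
    polynomials n = record
      { Carrier = Polynomial n ; _≈_ = _≡_ ; _+_ = _:+_ ; _*_ = _:*_ ; -_ = :-_
      ; 0# = 0ᴾ ; 1# = 1ᴾ }

    module ᴾ {n} = Coordinates (polynomials n)

  vector-≡ : ∀ {x₁ x₂ x₃ y₁ y₂ y₃ : Carrier} → x₁ ≡ y₁ → x₂ ≡ y₂ → x₃ ≡ y₃ → (x₁ , x₂ , x₃) ≡ (y₁ , y₂ , y₃)
  vector-≡ p q r = cong₂ _,_ p (cong₂ _,_ q r)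

  e₁-∙ : ∀ v → e₁ ∙ v ≡ π₁ v
  e₁-∙ (x , y , z) = solve 3 (λ x y z → ᴾ.e₁ ᴾ.∙ (x , y , z) := x) refl x y z

  e₂-∙ : ∀ v → e₂ ∙ v ≡ π₂ v
  e₂-∙ (x , y , z) = solve 3 (λ x y z → ᴾ.e₂ ᴾ.∙ (x , y , z) := y) refl x y z

  e₃-∙ : ∀ v → e₃ ∙ v ≡ π₃ v
  e₃-∙ (x , y , z) = solve 3 (λ x y z → ᴾ.e₃ ᴾ.∙ (x , y , z) := z) refl x y z

  ∙-ext : ∀ {v w} → (∀ u → u ∙ v ≡ u ∙ w) → v ≡ w
  ∙-ext {v} {w} h = vector-≡
    (trans (sym (e₁-∙ v)) (trans (h e₁) (e₁-∙ w)))
    (trans (sym (e₂-∙ v)) (trans (h e₂) (e₂-∙ w)))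
    (trans (sym (e₃-∙ v)) (trans (h e₃) (e₃-∙ w)))

  scale-zeroˡ : ∀ v → scale 0# v ≡ 0⃗
  scale-zeroˡ (x , y , z) = vector-≡ (*-zeroˡ x) (*-zeroˡ y) (*-zeroˡ z)

  scale-comm : ∀ s t v → scale s (scale t v) ≡ scale t (scale s v)
  scale-comm s t (x , y , z) = vector-≡ (swap x) (swap y) (swap z)
    where
    swap : ∀ w → s * (t * w) ≡ t * (s * w)
    swap = solve 3 (λ s t w → s :* (t :* w) := t :* (s :* w)) refl s t

  scale-cancel : ∀ {s v} → s ≢ 0# → scale s v ≡ 0⃗ → v ≡ 0⃗
  scale-cancel s≢0 sv≡0 = vector-≡
    (*≡0⇒≡0 s≢0 (cong π₁ sv≡0)) (*≡0⇒≡0 s≢0 (cong π₂ sv≡0)) (*≡0⇒≡0 s≢0 (cong π₃ sv≡0))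

  ∙-scaleˡ : ∀ s l x → scale s l ∙ x ≡ s * (l ∙ x)
  ∙-scaleˡ s (l₁ , l₂ , l₃) (x₁ , x₂ , x₃) =
    solve 7 (λ s l₁ l₂ l₃ x₁ x₂ x₃ → let l = (l₁ , l₂ , l₃) ; x = (x₁ , x₂ , x₃) in
               ᴾ.scale s l ᴾ.∙ x := s :* (l ᴾ.∙ x))
            refl s l₁ l₂ l₃ x₁ x₂ x₃

  ⨯-zeroʳ : ∀ v → v ⨯ 0⃗ ≡ 0⃗
  ⨯-zeroʳ (x , y , z) = vector-≡ (zero-term y z) (zero-term z x) (zero-term x y)
    where
    zero-term : ∀ s t → s * 0# + - (t * 0#) ≡ 0#
    zero-term = solve 2 (λ s t → s :* 0ᴾ :+ :- (t :* 0ᴾ) := 0ᴾ) refl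

  ⨯-annihilator : ∀ {p} → (∀ x → p ⨯ x ≡ 0⃗) → p ≡ 0⃗
  ⨯-annihilator {p₁ , p₂ , p₃} h = vector-≡
    (trans (solve 3 (λ p₁ p₂ p₃ → p₁ := ᴾ.π₃ ((p₁ , p₂ , p₃) ᴾ.⨯ ᴾ.e₂)) refl p₁ p₂ p₃) (cong π₃ (h e₂)))
    (trans (solve 3 (λ p₁ p₂ p₃ → p₂ := ᴾ.π₁ ((p₁ , p₂ , p₃) ᴾ.⨯ ᴾ.e₃)) refl p₁ p₂ p₃) (cong π₁ (h e₃)))
    (trans (solve 3 (λ p₁ p₂ p₃ → p₃ := ᴾ.π₂ ((p₁ , p₂ , p₃) ᴾ.⨯ ᴾ.e₁)) refl p₁ p₂ p₃) (cong π₂ (h e₁)))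

  scale-by-∙≡0⃗⇒≡0⃗ : ∀ {w} → (∀ z → scale (z ∙ w) w ≡ 0⃗) → w ≡ 0⃗
  scale-by-∙≡0⃗⇒≡0⃗ {w} h = vector-≡
    (x*x≡0⇒x≡0 (trans (cong (_* π₁ w) (sym (e₁-∙ w))) (cong π₁ (h e₁))))
    (x*x≡0⇒x≡0 (trans (cong (_* π₂ w) (sym (e₂-∙ w))) (cong π₂ (h e₂))))
    (x*x≡0⇒x≡0 (trans (cong (_* π₃ w) (sym (e₃-∙ w))) (cong π₃ (h e₃))))

  private
    pivot : ∀ {pᵢ i xᵢ pⱼ xⱼ} → pᵢ * i ≡ 1# → pⱼ * xᵢ ≡ pᵢ * xⱼ → xⱼ ≡ xᵢ * i * pⱼ
    pivot {pᵢ} {i} {xᵢ} {pⱼ} {xⱼ} pᵢi≡1 pⱼxᵢ≡pᵢxⱼ = begin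
      xⱼ              ≡⟨ *-identityˡ xⱼ ⟨
      1# * xⱼ         ≡⟨ cong (_* xⱼ) pᵢi≡1 ⟨
      pᵢ * i * xⱼ     ≡⟨ solve 3 (λ pᵢ i xⱼ → pᵢ :* i :* xⱼ := i :* (pᵢ :* xⱼ)) refl pᵢ i xⱼ ⟩
      i * (pᵢ * xⱼ)   ≡⟨ cong (i *_) pⱼxᵢ≡pᵢxⱼ ⟨
      i * (pⱼ * xᵢ)   ≡⟨ solve 3 (λ i pⱼ xᵢ → i :* (pⱼ :* xᵢ) := xᵢ :* i :* pⱼ) refl i pⱼ xᵢ ⟩
      xᵢ * i * pⱼ     ∎

    pivot-proportional : ∀ {p₁ p₂ p₃ x₁ x₂ x₃} → (p₁ , p₂ , p₃) ≢ 0⃗ →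
      p₂ * x₃ ≡ p₃ * x₂ → p₃ * x₁ ≡ p₁ * x₃ → p₁ * x₂ ≡ p₂ * x₁ →
      Σ Carrier λ t → (x₁ , x₂ , x₃) ≡ scale t (p₁ , p₂ , p₃)
    pivot-proportional {p₁} {p₂} {p₃} {x₁} {x₂} {x₃} p≢0 e₂₃ e₃₁ e₁₂
      with p₁ ≟ 0# | p₂ ≟ 0# | p₃ ≟ 0#
    ... | no p₁≢0 | _ | _ = let (i , p₁i≡1) = inverse p₁ p₁≢0 in
      x₁ * i , vector-≡ (pivot p₁i≡1 refl) (pivot p₁i≡1 (sym e₁₂)) (pivot p₁i≡1 e₃₁)
    ... | yes _ | no p₂≢0 | _ = let (i , p₂i≡1) = inverse p₂ p₂≢0 in
      x₂ * i , vector-≡ (pivot p₂i≡1 e₁₂) (pivot p₂i≡1 refl) (pivot p₂i≡1 (sym e₂₃))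
    ... | yes _ | yes _ | no p₃≢0 = let (i , p₃i≡1) = inverse p₃ p₃≢0 in
      x₃ * i , vector-≡ (pivot p₃i≡1 (sym e₃₁)) (pivot p₃i≡1 e₂₃) (pivot p₃i≡1 refl)
    ... | yes p₁≡0 | yes p₂≡0 | yes p₃≡0 = ⊥-elim (p≢0 (vector-≡ p₁≡0 p₂≡0 p₃≡0))

  ⨯≡0⃗⇒proportional : ∀ {p x} → p ≢ 0⃗ → p ⨯ x ≡ 0⃗ → Σ Carrier λ t → x ≡ scale t p
  ⨯≡0⃗⇒proportional p≢0 p⨯x≡0 = pivot-proportional p≢0
    (x-y≡0⇒x≡y _ _ (cong π₁ p⨯x≡0)) (x-y≡0⇒x≡y _ _ (cong π₂ p⨯x≡0)) (x-y≡0⇒x≡y _ _ (cong π₃ p⨯x≡0))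

  lagrange : ∀ z u v p x →
    scale (z ∙ (p ⨯ x)) (u ⨯ v) ≡
      scale ((u ∙ p) * (v ∙ x) + - ((u ∙ x) * (v ∙ p))) z
      ⊞ scale ((u ∙ x) * (z ∙ v) + - ((z ∙ u) * (v ∙ x))) p
      ⊞ scale ((z ∙ u) * (v ∙ p) + - ((u ∙ p) * (z ∙ v))) x
  lagrange (z₁ , z₂ , z₃) (u₁ , u₂ , u₃) (v₁ , v₂ , v₃) (p₁ , p₂ , p₃) (x₁ , x₂ , x₃) =
    ∙-ext λ (y₁ , y₂ , y₃) →
      solve 18 (λ y₁ y₂ y₃ z₁ z₂ z₃ u₁ u₂ u₃ v₁ v₂ v₃ p₁ p₂ p₃ x₁ x₂ x₃ →
        let y = (y₁ , y₂ , y₃) ; z = (z₁ , z₂ , z₃) ; u = (u₁ , u₂ , u₃)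
            v = (v₁ , v₂ , v₃) ; p = (p₁ , p₂ , p₃) ; x = (x₁ , x₂ , x₃)
        in  y ᴾ.∙ ᴾ.scale (z ᴾ.∙ (p ᴾ.⨯ x)) (u ᴾ.⨯ v)
            := y ᴾ.∙ (ᴾ.scale ((u ᴾ.∙ p) :* (v ᴾ.∙ x) :+ :- ((u ᴾ.∙ x) :* (v ᴾ.∙ p))) z
                      ᴾ.⊞ ᴾ.scale ((u ᴾ.∙ x) :* (z ᴾ.∙ v) :+ :- ((z ᴾ.∙ u) :* (v ᴾ.∙ x))) p
                      ᴾ.⊞ ᴾ.scale ((z ᴾ.∙ u) :* (v ᴾ.∙ p) :+ :- ((u ᴾ.∙ p) :* (z ᴾ.∙ v))) x))
        refl y₁ y₂ y₃ z₁ z₂ z₃ u₁ u₂ u₃ v₁ v₂ v₃ p₁ p₂ p₃ x₁ x₂ x₃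

  common-normals : ∀ {u v p x} → u ∙ p ≡ 0# → u ∙ x ≡ 0# → v ∙ p ≡ 0# → v ∙ x ≡ 0# →
                   ∀ z → scale (z ∙ (p ⨯ x)) (u ⨯ v) ≡ 0⃗
  common-normals {u} {v} {p} {x} u∙p≡0 u∙x≡0 v∙p≡0 v∙x≡0 z =
    trans (lagrange z u v p x) (vanishes (z ∙ u) (z ∙ v) u∙p≡0 u∙x≡0 v∙p≡0 v∙x≡0)
    where
    vanishes : ∀ {α β γ δ} μ ν → α ≡ 0# → β ≡ 0# → γ ≡ 0# → δ ≡ 0# →
      scale (α * δ + - (β * γ)) z ⊞ scale (β * ν + - (μ * δ)) p ⊞ scale (μ * γ + - (α * ν)) x ≡ 0⃗
    vanishes μ ν refl refl refl refl =
      vector-≡ (term (π₁ z) (π₁ p) (π₁ x)) (term (π₂ z) (π₂ p) (π₂ x)) (term (π₃ z) (π₃ p) (π₃ x))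
      where
      term : ∀ zᵢ pᵢ xᵢ →
        (0# * 0# + - (0# * 0#)) * zᵢ + (0# * ν + - (μ * 0#)) * pᵢ + (μ * 0# + - (0# * ν)) * xᵢ ≡ 0#
      term = solve 5 (λ μ ν zᵢ pᵢ xᵢ →
               (0ᴾ :* 0ᴾ :+ :- (0ᴾ :* 0ᴾ)) :* zᵢ :+ (0ᴾ :* ν :+ :- (μ :* 0ᴾ)) :* pᵢ
               :+ (μ :* 0ᴾ :+ :- (0ᴾ :* ν)) :* xᵢ := 0ᴾ) refl μ ν

  on-line-through-e₂ : ∀ {b₁ d₁ p} → b₁ ≢ 0# → (b₁ , 0# , d₁) ∙ p ≡ 0# → π₃ p ≢ 0# →
                       Σ Carrier λ y → Σ Carrier λ t → t ≢ 0# × p ≡ scale t (- d₁ , y , b₁)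
  on-line-through-e₂ {b₁} {d₁} {x , y , z} b₁≢0 p∈l z≢0 = y * t⁻¹ , t , t≢0 , vector-≡ x≡ y≡ z≡
    where
    i t t⁻¹ : Carrier
    i = proj₁ (inverse b₁ b₁≢0)
    t = z * i
    z≡ : z ≡ t * b₁
    z≡ = begin
      z           ≡⟨ *-identityˡ z ⟨
      1# * z      ≡⟨ cong (_* z) (proj₂ (inverse b₁ b₁≢0)) ⟨
      b₁ * i * z  ≡⟨ solve 3 (λ b₁ i z → b₁ :* i :* z := z :* i :* b₁) refl b₁ i z ⟩
      t * b₁      ∎
    t≢0 : t ≢ 0#
    t≢0 t≡0 = z≢0 (trans z≡ (trans (cong (_* b₁) t≡0) (*-zeroˡ b₁)))
    t⁻¹ = proj₁ (inverse t t≢0)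
    y≡ : y ≡ t * (y * t⁻¹)
    y≡ = begin
      y             ≡⟨ *-identityˡ y ⟨
      1# * y        ≡⟨ cong (_* y) (proj₂ (inverse t t≢0)) ⟨
      t * t⁻¹ * y   ≡⟨ solve 3 (λ t t⁻¹ y → t :* t⁻¹ :* y := t :* (y :* t⁻¹)) refl t t⁻¹ y ⟩
      t * (y * t⁻¹) ∎
    x≡ : x ≡ t * (- d₁)
    x≡ = begin
      x                                        ≡⟨ *-identityˡ x ⟨
      1# * x                                   ≡⟨ cong (_* x) (proj₂ (inverse b₁ b₁≢0)) ⟨
      b₁ * i * x                               ≡⟨ solve 6 (λ b₁ d₁ i x y z →
          b₁ :* i :* x := i :* (b₁ :* x :+ 0ᴾ :* y :+ d₁ :* z) :+ z :* i :* (:- d₁)) refl b₁ d₁ i x y z ⟩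
      i * ((b₁ , 0# , d₁) ∙ (x , y , z)) + t * (- d₁) ≡⟨ cong (λ s → i * s + t * (- d₁)) p∈l ⟩
      i * 0# + t * (- d₁)                      ≡⟨ solve 2 (λ i s → i :* 0ᴾ :+ s := s) refl i (t * (- d₁)) ⟩
      t * (- d₁)                               ∎

  module PlaneConicProperties (a b c d e : Carrier) where
    open PlaneConic a b c d e

    polar-self : ∀ p → polar p ∙ p ≡ form p + form p
    polar-self (x , y , z) =
      solve 8 (λ a b c d e x y z → let module C = ᴾ.PlaneConic a b c d e ; p = (x , y , z) in
                 C.polar p ᴾ.∙ p := C.form p :+ C.form p)
              refl a b c d e x y z

    polar-symmetric : ∀ p x → polar p ∙ x ≡ polar x ∙ p
    polar-symmetric (p₁ , p₂ , p₃) (x₁ , x₂ , x₃) =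
      solve 11 (λ a b c d e p₁ p₂ p₃ x₁ x₂ x₃ →
                  let module C = ᴾ.PlaneConic a b c d e ; p = (p₁ , p₂ , p₃) ; x = (x₁ , x₂ , x₃) in
                  C.polar p ᴾ.∙ x := C.polar x ᴾ.∙ p)
               refl a b c d e p₁ p₂ p₃ x₁ x₂ x₃

    -- M (M x ⨯ M p) = det M · (x ⨯ p) for the symmetric matrix M of the form, and det M = -2Δ.
    polar-cross : ∀ p x → polar (polar x ⨯ polar p) ≡ scale ((1# + 1#) * discriminant) (p ⨯ x)
    polar-cross (p₁ , p₂ , p₃) (x₁ , x₂ , x₃) = ∙-ext λ (y₁ , y₂ , y₃) →
      solve 14 (λ a b c d e p₁ p₂ p₃ x₁ x₂ x₃ y₁ y₂ y₃ →
                  let module C = ᴾ.PlaneConic a b c d e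
                      p = (p₁ , p₂ , p₃) ; x = (x₁ , x₂ , x₃) ; y = (y₁ , y₂ , y₃)
                  in  y ᴾ.∙ C.polar (C.polar x ᴾ.⨯ C.polar p)
                      := y ᴾ.∙ ᴾ.scale ((1ᴾ :+ 1ᴾ) :* C.discriminant) (p ᴾ.⨯ x))
               refl a b c d e p₁ p₂ p₃ x₁ x₂ x₃ y₁ y₂ y₃

    polar-scale : ∀ s v → polar (scale s v) ≡ scale s (polar v)
    polar-scale s (x , y , z) = ∙-ext λ (y₁ , y₂ , y₃) →
      solve 12 (λ a b c d e s x y z y₁ y₂ y₃ →
                  let module C = ᴾ.PlaneConic a b c d e ; v = (x , y , z) ; w = (y₁ , y₂ , y₃) in
                  w ᴾ.∙ C.polar (ᴾ.scale s v) := w ᴾ.∙ ᴾ.scale s (C.polar v))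
               refl a b c d e s x y z y₁ y₂ y₃

    on-own-polar : ∀ {p} → form p ≡ 0# → polar p ∙ p ≡ 0#
    on-own-polar {p} p∈C = trans (polar-self p) (trans (cong₂ _+_ p∈C p∈C) (+-identityʳ 0#))

    polar-0⃗ : polar 0⃗ ≡ 0⃗
    polar-0⃗ = trans (cong polar (sym (scale-zeroˡ 0⃗))) (trans (polar-scale 0# 0⃗) (scale-zeroˡ (polar 0⃗)))

    polar-e₂-∙ : ∀ x → polar e₂ ∙ x ≡ b * π₁ x + d * π₃ x
    polar-e₂-∙ (x₁ , x₂ , x₃) =
      solve 8 (λ a b c d e x₁ x₂ x₃ → ᴾ.PlaneConic.polar a b c d e ᴾ.e₂ ᴾ.∙ (x₁ , x₂ , x₃)
                                       := b :* x₁ :+ d :* x₃)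
              refl a b c d e x₁ x₂ x₃

    form-Y : ∀ y → form (0# , y , 0#) ≡ 0#
    form-Y = solve 6 (λ a b c d e y → ᴾ.PlaneConic.form a b c d e (0ᴾ , y , 0ᴾ) := 0ᴾ) refl a b c d e

    form-e₂ : form e₂ ≡ 0#
    form-e₂ = form-Y 1#

    secondIntersection-∈C : ∀ n → form (secondIntersection n) ≡ 0#
    secondIntersection-∈C (n₁ , n₂ , n₃) =
      solve 8 (λ a b c d e n₁ n₂ n₃ → let module C = ᴾ.PlaneConic a b c d e in
                 C.form (C.secondIntersection (n₁ , n₂ , n₃)) := 0ᴾ)
              refl a b c d e n₁ n₂ n₃

    ∙-secondIntersection : ∀ n → n ∙ secondIntersection n ≡ (n ∙ e₂) * π₂ (secondIntersection n)
    ∙-secondIntersection (n₁ , n₂ , n₃) =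
      solve 8 (λ a b c d e n₁ n₂ n₃ → let module C = ᴾ.PlaneConic a b c d e ; n = (n₁ , n₂ , n₃) in
                 n ᴾ.∙ C.secondIntersection n := (n ᴾ.∙ ᴾ.e₂) :* ᴾ.π₂ (C.secondIntersection n))
              refl a b c d e n₁ n₂ n₃

    β-polar : ∀ r → b * β (polar r) ≡
                    (1# + 1#) * π₃ r * discriminant + (b * c + - ((a + a) * d)) * (polar e₂ ∙ r)
    β-polar (x , y , z) =
      solve 8 (λ a b c d e x y z → let module C = ᴾ.PlaneConic a b c d e ; r = (x , y , z) in
                 b :* C.β (C.polar r)
                 := (1ᴾ :+ 1ᴾ) :* z :* C.discriminant
                    :+ (b :* c :+ :- ((a :+ a) :* d)) :* (C.polar ᴾ.e₂ ᴾ.∙ r))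
              refl a b c d e x y z

    secondIntersection≢scale-e₂ : ∀ {n} → β n ≢ 0# → ∀ t → secondIntersection n ≢ scale t e₂
    secondIntersection≢scale-e₂ {n₁ , n₂ , n₃} βn≢0 t q≡te₂ = βn≢0 (begin
      b * n₃ + - (d * n₁)    ≡⟨ cong₂ (λ u v → b * u + - (d * v)) n₃≡0 n₁≡0 ⟩
      b * 0# + - (d * 0#)    ≡⟨ solve 2 (λ b d → b :* 0ᴾ :+ :- (d :* 0ᴾ) := 0ᴾ) refl b d ⟩
      0#                     ∎)
      where
      n₃≡0 : n₃ ≡ 0#
      n₃≡0 = *≡0⇒≡0 βn≢0 (-x≡0⇒x≡0 (trans (cong π₁ q≡te₂) (*-zeroʳ t)))
      n₁≡0 : n₁ ≡ 0#
      n₁≡0 = *≡0⇒≡0 βn≢0 (trans (cong π₃ q≡te₂) (*-zeroʳ t))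

  e₂≢0⃗ : e₂ ≢ 0⃗
  e₂≢0⃗ e₂≡0⃗ = 1≢0 (cong π₂ e₂≡0⃗)

  module NondegenerateConic (a b c d e : Carrier)
                            (nondegenerate : PlaneConic.discriminant a b c d e ≢ 0#) where
    open PlaneConic a b c d e public
    open PlaneConicProperties a b c d e public

    2Δ≢0 : (1# + 1#) * discriminant ≢ 0#
    2Δ≢0 = *≢0 char≢2 nondegenerate

    polar-nonzero : ∀ {p} → p ≢ 0⃗ → polar p ≢ 0⃗
    polar-nonzero {p} p≢0 polar-p≡0 = p≢0 (⨯-annihilator λ x → scale-cancel 2Δ≢0 (begin
      scale ((1# + 1#) * discriminant) (p ⨯ x)  ≡⟨ polar-cross p x ⟨
      polar (polar x ⨯ polar p)                ≡⟨ cong (λ v → polar (polar x ⨯ v)) polar-p≡0 ⟩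
      polar (polar x ⨯ 0⃗)                     ≡⟨ cong polar (⨯-zeroʳ (polar x)) ⟩
      polar 0⃗                                 ≡⟨ polar-0⃗ ⟩
      0⃗                                       ∎))

    tangent-meets-conic-once : ∀ {p x} → p ≢ 0⃗ → form p ≡ 0# → form x ≡ 0# → polar p ∙ x ≡ 0# →
                               Σ Carrier λ t → x ≡ scale t p
    tangent-meets-conic-once {p} {x} p≢0 p∈C x∈C x∈Tp = ⨯≡0⃗⇒proportional {p} {x} p≢0
      (scale-by-∙≡0⃗⇒≡0⃗ {w} λ z → scale-cancel {k} {scale (z ∙ w) w} 2Δ≢0 (annihilated z))
      where
      k : Carrier
      k = (1# + 1#) * discriminant
      w : Vector
      w = p ⨯ x
      normals : ∀ z → scale (z ∙ w) (polar x ⨯ polar p) ≡ 0⃗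
      normals = common-normals {polar x} {polar p} {p} {x}
        (trans (polar-symmetric x p) x∈Tp) (on-own-polar {x} x∈C) (on-own-polar {p} p∈C) x∈Tp
      annihilated : ∀ z → scale k (scale (z ∙ w) w) ≡ 0⃗
      annihilated z = begin
        scale k (scale (z ∙ w) w)                  ≡⟨ scale-comm k (z ∙ w) w ⟩
        scale (z ∙ w) (scale k w)                  ≡⟨ cong (scale (z ∙ w)) (polar-cross p x) ⟨
        scale (z ∙ w) (polar (polar x ⨯ polar p))  ≡⟨ polar-scale (z ∙ w) (polar x ⨯ polar p) ⟨
        polar (scale (z ∙ w) (polar x ⨯ polar p))  ≡⟨ cong polar (normals z) ⟩
        polar 0⃗                                   ≡⟨ polar-0⃗ ⟩
        0⃗                                         ∎

    off-conic : ∀ {r} → polar e₂ ∙ r ≡ 0# → π₃ r ≢ 0# → form r ≢ 0#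
    off-conic {r} r∈Te₂ r₃≢0 r∈C = r₃≢0 (trans (cong π₃ (proj₂ r∝e₂)) (*-zeroʳ (proj₁ r∝e₂)))
      where
      r∝e₂ : Σ Carrier λ t → r ≡ scale t e₂
      r∝e₂ = tangent-meets-conic-once {e₂} {r} e₂≢0⃗ form-e₂ r∈C r∈Te₂

    β-polar≢0 : ∀ {r} → polar e₂ ∙ r ≡ 0# → π₃ r ≢ 0# → β (polar r) ≢ 0#
    β-polar≢0 {r} r∈Te₂ r₃≢0 β≡0 = *≢0 (*≢0 char≢2 r₃≢0) nondegenerate (begin
      δ                        ≡⟨ +-identityʳ δ ⟨
      δ + 0#                   ≡⟨ cong (δ +_) (*-zeroʳ κ) ⟨
      δ + κ * 0#               ≡⟨ cong (λ t → δ + κ * t) r∈Te₂ ⟨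
      δ + κ * (polar e₂ ∙ r)   ≡⟨ β-polar r ⟨
      b * β (polar r)          ≡⟨ cong (b *_) β≡0 ⟩
      b * 0#                   ≡⟨ *-zeroʳ b ⟩
      0#                       ∎)
      where
      δ κ : Carrier
      δ = (1# + 1#) * π₃ r * discriminant
      κ = b * c + - ((a + a) * d)

    second-tangent : ∀ {r} → polar e₂ ∙ r ≡ 0# → π₃ r ≢ 0# →
      Σ Vector λ q → form q ≡ 0# × (∀ t → q ≢ scale t e₂) × polar q ∙ r ≡ 0#
    second-tangent {r} r∈Te₂ r₃≢0 =
      q , secondIntersection-∈C n , secondIntersection≢scale-e₂ {n} (β-polar≢0 {r} r∈Te₂ r₃≢0) , (begin
        polar q ∙ r      ≡⟨ polar-symmetric q r ⟩
        polar r ∙ q      ≡⟨ ∙-secondIntersection n ⟩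
        (n ∙ e₂) * π₂ q  ≡⟨ cong (_* π₂ q) (trans (polar-symmetric r e₂) r∈Te₂) ⟩
        0# * π₂ q        ≡⟨ *-zeroˡ (π₂ q) ⟩
        0#               ∎)
      where
      n q : Vector
      n = polar r
      q = secondIntersection n

module QuadraticExtension (F : FiniteOddField) (ω : FiniteOddField.K F)
                          (nonSquare : FiniteOddField.NonSquare F ω) where
  open FieldProperties (oddCharacteristicField F)
  open CommutativeRing commutativeRing
    using (+-assoc; +-comm; +-identityˡ; -‿inverseˡ; -‿inverseʳ)
  open Ext F ω
  open ≡-Reasoning

  infix 8 ⊖_

  ⊖_ : K₂ → K₂
  ⊖ (x₁ , x₂) = (- x₁ , - x₂)

  norm : K₂ → Carrier
  norm (x₁ , x₂) = x₁ * x₁ + - (ω * (x₂ * x₂))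

  private
    mulᴾ : ∀ {n} → Polynomial n → Polynomial n × Polynomial n → Polynomial n × Polynomial n →
           Polynomial n × Polynomial n
    mulᴾ w (x₁ , x₂) (y₁ , y₂) = (x₁ :* y₁ :+ w :* (x₂ :* y₂) , x₁ :* y₂ :+ x₂ :* y₁)

  ⊕-assoc : ∀ x y z → (x ⊕ y) ⊕ z ≡ x ⊕ (y ⊕ z)
  ⊕-assoc (x₁ , x₂) (y₁ , y₂) (z₁ , z₂) = cong₂ _,_ (+-assoc x₁ y₁ z₁) (+-assoc x₂ y₂ z₂)

  ⊕-comm : ∀ x y → x ⊕ y ≡ y ⊕ x
  ⊕-comm (x₁ , x₂) (y₁ , y₂) = cong₂ _,_ (+-comm x₁ y₁) (+-comm x₂ y₂)

  ⊕-identityˡ : ∀ x → 0₂ ⊕ x ≡ x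
  ⊕-identityˡ (x₁ , x₂) = cong₂ _,_ (+-identityˡ x₁) (+-identityˡ x₂)

  ⊕-identityʳ : ∀ x → x ⊕ 0₂ ≡ x
  ⊕-identityʳ (x₁ , x₂) = cong₂ _,_ (+-identityʳ x₁) (+-identityʳ x₂)

  ⊖-inverseˡ : ∀ x → ⊖ x ⊕ x ≡ 0₂
  ⊖-inverseˡ (x₁ , x₂) = cong₂ _,_ (-‿inverseˡ x₁) (-‿inverseˡ x₂)

  ⊖-inverseʳ : ∀ x → x ⊕ ⊖ x ≡ 0₂
  ⊖-inverseʳ (x₁ , x₂) = cong₂ _,_ (-‿inverseʳ x₁) (-‿inverseʳ x₂)

  ⊗-assoc : ∀ x y z → (x ⊗ y) ⊗ z ≡ x ⊗ (y ⊗ z)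
  ⊗-assoc (x₁ , x₂) (y₁ , y₂) (z₁ , z₂) = cong₂ _,_
    (solve 7 (λ w x₁ x₂ y₁ y₂ z₁ z₂ → let x = (x₁ , x₂) ; y = (y₁ , y₂) ; z = (z₁ , z₂) in
                proj₁ (mulᴾ w (mulᴾ w x y) z) := proj₁ (mulᴾ w x (mulᴾ w y z)))
             refl ω x₁ x₂ y₁ y₂ z₁ z₂)
    (solve 7 (λ w x₁ x₂ y₁ y₂ z₁ z₂ → let x = (x₁ , x₂) ; y = (y₁ , y₂) ; z = (z₁ , z₂) in
                proj₂ (mulᴾ w (mulᴾ w x y) z) := proj₂ (mulᴾ w x (mulᴾ w y z)))
             refl ω x₁ x₂ y₁ y₂ z₁ z₂)

  ⊗-comm : ∀ x y → x ⊗ y ≡ y ⊗ x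
  ⊗-comm (x₁ , x₂) (y₁ , y₂) = cong₂ _,_
    (solve 5 (λ w x₁ x₂ y₁ y₂ → proj₁ (mulᴾ w (x₁ , x₂) (y₁ , y₂)) := proj₁ (mulᴾ w (y₁ , y₂) (x₁ , x₂)))
             refl ω x₁ x₂ y₁ y₂)
    (solve 5 (λ w x₁ x₂ y₁ y₂ → proj₂ (mulᴾ w (x₁ , x₂) (y₁ , y₂)) := proj₂ (mulᴾ w (y₁ , y₂) (x₁ , x₂)))
             refl ω x₁ x₂ y₁ y₂)

  ⊗-identityˡ : ∀ x → 1₂ ⊗ x ≡ x
  ⊗-identityˡ (x₁ , x₂) = cong₂ _,_
    (solve 3 (λ w x₁ x₂ → proj₁ (mulᴾ w (1ᴾ , 0ᴾ) (x₁ , x₂)) := x₁) refl ω x₁ x₂)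
    (solve 3 (λ w x₁ x₂ → proj₂ (mulᴾ w (1ᴾ , 0ᴾ) (x₁ , x₂)) := x₂) refl ω x₁ x₂)

  ⊗-identityʳ : ∀ x → x ⊗ 1₂ ≡ x
  ⊗-identityʳ x = trans (⊗-comm x 1₂) (⊗-identityˡ x)

  ⊗-distribˡ : ∀ x y z → x ⊗ (y ⊕ z) ≡ x ⊗ y ⊕ x ⊗ z
  ⊗-distribˡ (x₁ , x₂) (y₁ , y₂) (z₁ , z₂) = cong₂ _,_
    (solve 7 (λ w x₁ x₂ y₁ y₂ z₁ z₂ → let x = (x₁ , x₂) in
                proj₁ (mulᴾ w x (y₁ :+ z₁ , y₂ :+ z₂))
                := proj₁ (mulᴾ w x (y₁ , y₂)) :+ proj₁ (mulᴾ w x (z₁ , z₂)))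
             refl ω x₁ x₂ y₁ y₂ z₁ z₂)
    (solve 7 (λ w x₁ x₂ y₁ y₂ z₁ z₂ → let x = (x₁ , x₂) in
                proj₂ (mulᴾ w x (y₁ :+ z₁ , y₂ :+ z₂))
                := proj₂ (mulᴾ w x (y₁ , y₂)) :+ proj₂ (mulᴾ w x (z₁ , z₂)))
             refl ω x₁ x₂ y₁ y₂ z₁ z₂)

  ⊗-distribʳ : ∀ x y z → (y ⊕ z) ⊗ x ≡ y ⊗ x ⊕ z ⊗ x
  ⊗-distribʳ x y z = begin
    (y ⊕ z) ⊗ x    ≡⟨ ⊗-comm (y ⊕ z) x ⟩
    x ⊗ (y ⊕ z)    ≡⟨ ⊗-distribˡ x y z ⟩
    x ⊗ y ⊕ x ⊗ z  ≡⟨ cong₂ _⊕_ (⊗-comm x y) (⊗-comm x z) ⟩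
    y ⊗ x ⊕ z ⊗ x  ∎

  isCommutativeRing₂ : IsCommutativeRing _≡_ _⊕_ _⊗_ ⊖_ 0₂ 1₂
  isCommutativeRing₂ = record
    { isRing = record
      { +-isAbelianGroup = record
        { isGroup = record
          { isMonoid = record
            { isSemigroup = record
              { isMagma = record { isEquivalence = ≡.isEquivalence ; ∙-cong = cong₂ _⊕_ }
              ; assoc   = ⊕-assoc }
            ; identity = ⊕-identityˡ , ⊕-identityʳ }
          ; inverse = ⊖-inverseˡ , ⊖-inverseʳ
          ; ⁻¹-cong = cong ⊖_ }
        ; comm = ⊕-comm }
      ; *-cong     = cong₂ _⊗_
      ; *-assoc    = ⊗-assoc
      ; *-identity = ⊗-identityˡ , ⊗-identityʳ
      ; distrib    = ⊗-distribˡ , ⊗-distribʳ }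
    ; *-comm = ⊗-comm }

  -- A zero of the norm with x₂ ≢ 0 would make ω = (x₁ / x₂)² a square.
  norm≢0 : ∀ {x} → x ≢ 0₂ → norm x ≢ 0#
  norm≢0 {x₁ , x₂} x≢0 N≡0 with x₂ ≟ 0#
  ... | yes x₂≡0 = x≢0 (cong₂ _,_ (x*x≡0⇒x≡0 (begin
    x₁ * x₁                          ≡⟨ solve 2 (λ x₁ w → x₁ :* x₁ := x₁ :* x₁ :+ :- (w :* (0ᴾ :* 0ᴾ)))
                                                refl x₁ ω ⟩
    x₁ * x₁ + - (ω * (0# * 0#))      ≡⟨ cong (λ t → x₁ * x₁ + - (ω * (t * t))) x₂≡0 ⟨
    norm (x₁ , x₂)                   ≡⟨ N≡0 ⟩
    0#                               ∎)) x₂≡0)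
  ... | no x₂≢0 = nonSquare (x₁ * i) (begin
    x₁ * i * (x₁ * i)                                   ≡⟨ solve 4 (λ x₁ x₂ i w →
        x₁ :* i :* (x₁ :* i) := (x₁ :* x₁ :+ :- (w :* (x₂ :* x₂))) :* (i :* i) :+ w :* (x₂ :* i :* (x₂ :* i)))
        refl x₁ x₂ i ω ⟩
    norm (x₁ , x₂) * (i * i) + ω * (x₂ * i * (x₂ * i))  ≡⟨ cong₂ (λ n u → n * (i * i) + ω * (u * u)) N≡0 x₂i≡1 ⟩
    0# * (i * i) + ω * (1# * 1#)                        ≡⟨ solve 2 (λ i w →
        0ᴾ :* (i :* i) :+ w :* (1ᴾ :* 1ᴾ) := w) refl i ω ⟩
    ω                                                   ∎)
    where
    i : Carrier
    i = proj₁ (inverse x₂ x₂≢0)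
    x₂i≡1 : x₂ * i ≡ 1#
    x₂i≡1 = proj₂ (inverse x₂ x₂≢0)

  inverse₂ : ∀ x → x ≢ 0₂ → Σ K₂ λ y → x ⊗ y ≡ 1₂
  inverse₂ x@(x₁ , x₂) x≢0 = (x₁ * n⁻¹ , - (x₂ * n⁻¹)) , cong₂ _,_
    (trans (solve 4 (λ x₁ x₂ n⁻¹ w → x₁ :* (x₁ :* n⁻¹) :+ w :* (x₂ :* :- (x₂ :* n⁻¹))
                                      := (x₁ :* x₁ :+ :- (w :* (x₂ :* x₂))) :* n⁻¹)
                  refl x₁ x₂ n⁻¹ ω)
           (proj₂ (inverse (norm x) (norm≢0 x≢0))))
    (solve 3 (λ x₁ x₂ n⁻¹ → x₁ :* :- (x₂ :* n⁻¹) :+ x₂ :* (x₁ :* n⁻¹) := 0ᴾ) refl x₁ x₂ n⁻¹)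
    where
    n⁻¹ : Carrier
    n⁻¹ = proj₁ (inverse (norm x) (norm≢0 x≢0))

  quadraticExtension : OddCharacteristicField
  quadraticExtension = record
    { Carrier = K₂ ; _+_ = _⊕_ ; _*_ = _⊗_ ; -_ = ⊖_ ; 0# = 0₂ ; 1# = 1₂
    ; isCommutativeRing = isCommutativeRing₂
    ; _≟_ = ≡-dec _≟_ _≟_
    ; inverse = inverse₂
    ; char≢2 = λ 2≡0 → char≢2 (cong proj₁ 2≡0) }

  ι-injective : ∀ {u v} → ι u ≡ ι v → u ≡ v
  ι-injective = cong proj₁

  ι-⊕ : ∀ u v → ι u ⊕ ι v ≡ ι (u + v)
  ι-⊕ u v = cong (u + v ,_) (+-identityʳ 0#)

  ι-⊗ : ∀ u v → ι u ⊗ ι v ≡ ι (u * v)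
  ι-⊗ u v = cong₂ _,_
    (solve 3 (λ u v w → u :* v :+ w :* (0ᴾ :* 0ᴾ) := u :* v) refl u v ω)
    (solve 2 (λ u v → u :* 0ᴾ :+ 0ᴾ :* v := 0ᴾ) refl u v)

module ConicOverQuadraticExtension
  (F : FiniteOddField) (ω : FiniteOddField.K F) (nonSquare : FiniteOddField.NonSquare F ω)
  (a b c d e : Ext.K₂ F ω) where
  open FiniteOddField F using (K; _+_; _*_; -_; 0#; 1#; elements; complete)
  open Ext F ω
  open Conic a b c d e using (OnC; Irreducible; TangentAt; External)
  open QuadraticExtension F ω nonSquare
  module 𝔽 = FieldProperties (oddCharacteristicField F)
  module 𝔽₂ = FieldProperties quadraticExtension
  module ℙ = Geometry (oddCharacteristicField F)
  module ℙ₂ = Geometry quadraticExtension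
  open ℙ₂ using (e₂; e₂≢0⃗; π₁; π₂; π₃; _∙_)
  open ≡-Reasoning

  embed-∙ : ∀ u v → embed u ∙ embed v ≡ ι (u ℙ.∙ v)
  embed-∙ (u₁ , u₂ , u₃) (v₁ , v₂ , v₃) = begin
    ι u₁ ⊗ ι v₁ ⊕ ι u₂ ⊗ ι v₂ ⊕ ι u₃ ⊗ ι v₃   ≡⟨ cong₂ _⊕_ (cong₂ _⊕_ (ι-⊗ u₁ v₁) (ι-⊗ u₂ v₂)) (ι-⊗ u₃ v₃) ⟩
    ι (u₁ * v₁) ⊕ ι (u₂ * v₂) ⊕ ι (u₃ * v₃)   ≡⟨ cong (_⊕ ι (u₃ * v₃)) (ι-⊕ (u₁ * v₁) (u₂ * v₂)) ⟩
    ι (u₁ * v₁ + u₂ * v₂) ⊕ ι (u₃ * v₃)       ≡⟨ ι-⊕ (u₁ * v₁ + u₂ * v₂) (u₃ * v₃) ⟩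
    ι (u₁ * v₁ + u₂ * v₂ + u₃ * v₃)           ∎

  embed-scale : ∀ t v → embed (ℙ.scale t v) ≡ scale (ι t) (embed v)
  embed-scale t (v₁ , v₂ , v₃) = ℙ₂.vector-≡ (sym (ι-⊗ t v₁)) (sym (ι-⊗ t v₂)) (sym (ι-⊗ t v₃))

  discriminant≢0 : Irreducible → ℙ₂.PlaneConic.discriminant a b c d e ≢ 0₂
  discriminant≢0 irreducible Δ≡0 = irreducible
    (≡.subst (λ m → a ⊗ d ⊗ d ⊕ e ⊗ b ⊗ b ⊕ m ⊗ b ⊗ c ⊗ d ≡ 0₂) (cong (- 1# ,_) 𝔽.-0#≡0#) Δ≡0)

  multiple⇒proportional : ∀ {x p t} → NonZero x → x ≡ scale t p → Proportional x p
  multiple⇒proportional {x} {p} {t} x≢0 x≡tp =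
    t , (λ t≡0 → x≢0 (trans x≡tp (trans (cong (λ s → scale s p) t≡0) (ℙ₂.scale-zeroˡ p)))) , x≡tp

  module _ (irreducible : Irreducible) where
    open ℙ₂.NondegenerateConic a b c d e (discriminant≢0 irreducible)
      using (polar; on-own-polar; polar-nonzero; tangent-meets-conic-once; polar-e₂-∙; form-Y; form-e₂;
             off-conic; second-tangent)

    tangentAt : ∀ {l p} → NonZero l → NonZero p → OnC p → OnLine l p →
                (∀ {x} → OnLine l x → polar p ∙ x ≡ 0₂) → TangentAt l p
    tangentAt {l} {p} l≢0 p≢0 p∈C p∈l l⊆Tp = l≢0 , p≢0 , p∈C , p∈l , meets-once
      where
      meets-once : ∀ x → NonZero x → OnC x → OnLine l x → Proportional x p
      meets-once x x≢0 x∈C x∈l =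
        multiple⇒proportional x≢0 (proj₂ (tangent-meets-conic-once {p} {x} p≢0 p∈C x∈C (l⊆Tp x∈l)))

    tangentAt-polar : ∀ {p} → NonZero p → OnC p → TangentAt (polar p) p
    tangentAt-polar {p} p≢0 p∈C = tangentAt (polar-nonzero {p} p≢0) p≢0 p∈C (on-own-polar {p} p∈C) id

    external : ∀ {r} → OnLine (polar e₂) r → π₃ r ≢ 0₂ → External r
    external {r} r∈Te₂ r₃≢0 =
      (λ r≡0 → r₃≢0 (cong π₃ r≡0)) , off-conic {r} r∈Te₂ r₃≢0 , polar e₂ , polar q ,
      (e₂ , tangentAt-polar e₂≢0⃗ form-e₂) , (q , tangentAt-polar q≢0 q∈C) ,
      tangents-differ , r∈Te₂ , r∈Tq
      where
      q : Triple
      q = proj₁ (second-tangent {r} r∈Te₂ r₃≢0)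
      q∈C : OnC q
      q∈C = proj₁ (proj₂ (second-tangent {r} r∈Te₂ r₃≢0))
      q≢te₂ : ∀ t → q ≢ scale t e₂
      q≢te₂ = proj₁ (proj₂ (proj₂ (second-tangent {r} r∈Te₂ r₃≢0)))
      r∈Tq : OnLine (polar q) r
      r∈Tq = proj₂ (proj₂ (proj₂ (second-tangent {r} r∈Te₂ r₃≢0)))
      q≢0 : NonZero q
      q≢0 q≡0 = q≢te₂ 0₂ (trans q≡0 (sym (ℙ₂.scale-zeroˡ e₂)))
      tangents-differ : ¬ Proportional (polar e₂) (polar q)
      tangents-differ (s , _ , Te₂≡sTq) =
        q≢te₂ _ (proj₂ (tangent-meets-conic-once {e₂} {q} e₂≢0⃗ form-e₂ q∈C (begin
          polar e₂ ∙ q            ≡⟨ cong (_∙ q) Te₂≡sTq ⟩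
          scale s (polar q) ∙ q   ≡⟨ ℙ₂.∙-scaleˡ s (polar q) q ⟩
          s ⊗ (polar q ∙ q)       ≡⟨ cong (s ⊗_) (on-own-polar {q} q∈C) ⟩
          s ⊗ 0₂                  ≡⟨ 𝔽₂.*-zeroʳ s ⟩
          0₂                      ∎)))

    module RationalTangent (b≢0 : b ≢ 0₂) (b₁d₂≡d₁b₂ : proj₁ b * proj₂ d ≡ proj₁ d * proj₂ b)
                           (b₁,d₁≢0 : ¬ (proj₁ b ≡ 0# × proj₁ d ≡ 0#)) where
      b₁ d₁ : K
      b₁ = proj₁ b
      d₁ = proj₁ d

      L₀ : K × K × K
      L₀ = (b₁ , 0# , d₁)

      b₁≢0 : b₁ ≢ 0#
      b₁≢0 b₁≡0 = b≢0 (cong₂ _,_ b₁≡0 (𝔽.*≡0⇒≡0 d₁≢0 (begin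
        d₁ * proj₂ b   ≡⟨ b₁d₂≡d₁b₂ ⟨
        b₁ * proj₂ d   ≡⟨ cong (_* proj₂ d) b₁≡0 ⟩
        0# * proj₂ d   ≡⟨ 𝔽.*-zeroˡ (proj₂ d) ⟩
        0#             ∎)))
        where
        d₁≢0 : d₁ ≢ 0#
        d₁≢0 d₁≡0 = b₁,d₁≢0 (b₁≡0 , d₁≡0)

      ιb₁≢0 : ι b₁ ≢ 0₂
      ιb₁≢0 ιb₁≡0 = b₁≢0 (ι-injective ιb₁≡0)

      b⊗ιd₁≡d⊗ιb₁ : b ⊗ ι d₁ ≡ d ⊗ ι b₁
      b⊗ιd₁≡d⊗ιb₁ = cong₂ _,_
        (𝔽.solve 5 (λ b₁ b₂ d₁ d₂ w → b₁ :* d₁ :+ w :* (b₂ :* 0ᴾ) := d₁ :* b₁ :+ w :* (d₂ :* 0ᴾ))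
                   refl b₁ (proj₂ b) d₁ (proj₂ d) ω)
        (begin
          b₁ * 0# + proj₂ b * d₁   ≡⟨ 𝔽.solve 3 (λ b₁ b₂ d₁ → b₁ :* 0ᴾ :+ b₂ :* d₁ := d₁ :* b₂)
                                                refl b₁ (proj₂ b) d₁ ⟩
          d₁ * proj₂ b             ≡⟨ b₁d₂≡d₁b₂ ⟨
          b₁ * proj₂ d             ≡⟨ 𝔽.solve 3 (λ b₁ d₂ d₁ → b₁ :* d₂ := d₁ :* 0ᴾ :+ d₂ :* b₁)
                                                refl b₁ (proj₂ d) d₁ ⟩
          d₁ * 0# + proj₂ d * b₁   ∎)
        where open 𝔽 using (_:=_; _:+_; _:*_; 0ᴾ)

      -- The tangent at e₂ is bX + dZ = 0, and (b , d) is a multiple of (b₁ , d₁).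
      L⊆Te₂ : ∀ {x} → OnLine (embed L₀) x → OnLine (polar e₂) x
      L⊆Te₂ {x} x∈L = 𝔽₂.*-cancelˡ ιb₁≢0 (begin
        ι b₁ ⊗ (polar e₂ ∙ x)                              ≡⟨ cong (ι b₁ ⊗_) (polar-e₂-∙ x) ⟩
        ι b₁ ⊗ (b ⊗ π₁ x ⊕ d ⊗ π₃ x)                     ≡⟨ 𝔽₂.solve 7 (λ β₁ δ₁ b d x₁ x₂ x₃ →
            β₁ :* (b :* x₁ :+ d :* x₃)
            := b :* (β₁ :* x₁ :+ 0ᴾ :* x₂ :+ δ₁ :* x₃) :+ (d :* β₁ :+ :- (b :* δ₁)) :* x₃)
            refl (ι b₁) (ι d₁) b d (π₁ x) (π₂ x) (π₃ x) ⟩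
        b ⊗ (embed L₀ ∙ x) ⊕ (d ⊗ ι b₁ ⊕ ⊖ (b ⊗ ι d₁)) ⊗ π₃ x ≡⟨ cong₂ (λ s u → b ⊗ s ⊕ (d ⊗ ι b₁ ⊕ ⊖ u) ⊗ π₃ x)
                                                               x∈L b⊗ιd₁≡d⊗ιb₁ ⟩
        b ⊗ 0₂ ⊕ (d ⊗ ι b₁ ⊕ ⊖ (d ⊗ ι b₁)) ⊗ π₃ x         ≡⟨ 𝔽₂.solve 4 (λ β₁ b u x₃ →
            b :* 0ᴾ :+ (u :+ :- u) :* x₃ := β₁ :* 0ᴾ) refl (ι b₁) b (d ⊗ ι b₁) (π₃ x) ⟩
        ι b₁ ⊗ 0₂                                          ∎)
        where open 𝔽₂ using (_:=_; _:+_; _:*_; :-_; 0ᴾ)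

      tangentAt-L : TangentAt (embed L₀) e₂
      tangentAt-L = tangentAt (λ L≡0 → ιb₁≢0 (cong proj₁ L≡0)) e₂≢0⃗ form-e₂ e₂∈L L⊆Te₂
        where
        e₂∈L : OnLine (embed L₀) e₂
        e₂∈L = 𝔽₂.solve 2 (λ β₁ δ₁ → β₁ :* 0ᴾ :+ 0ᴾ :* 1ᴾ :+ δ₁ :* 0ᴾ := 0ᴾ) refl (ι b₁) (ι d₁)
          where open 𝔽₂ using (_:=_; _:+_; _:*_; 0ᴾ; 1ᴾ)

      linePoint : K → K × K × K
      linePoint y = (- d₁ , y , b₁)

      linePoint-on-L : ∀ y → OnLine (embed L₀) (embed (linePoint y))
      linePoint-on-L y = trans (embed-∙ L₀ (linePoint y))
        (cong ι (𝔽.solve 3 (λ b₁ d₁ y → b₁ :* :- d₁ :+ 0ᴾ :* y :+ d₁ :* b₁ := 0ᴾ) refl b₁ d₁ y))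
        where open 𝔽 using (_:=_; _:+_; _:*_; :-_; 0ᴾ)

      linePoint-external : ∀ y → External (embed (linePoint y))
      linePoint-external y = external (L⊆Te₂ (linePoint-on-L y)) ιb₁≢0

      linePoints-distinct : ∀ {y y′} → y ≢ y′ → ¬ Proportional (embed (linePoint y)) (embed (linePoint y′))
      linePoints-distinct {y} {y′} y≢y′ (t , _ , eq) = y≢y′ (ι-injective (begin
        ι y          ≡⟨ cong π₂ eq ⟩
        t ⊗ ι y′     ≡⟨ cong (_⊗ ι y′) (𝔽₂.z≡t*z⇒t≡1 ιb₁≢0 (cong π₃ eq)) ⟩
        1₂ ⊗ ι y′    ≡⟨ ⊗-identityˡ (ι y′) ⟩
        ι y′         ∎))

      linePoints-complete : ∀ p → OnLine (embed L₀) (embed p) → ¬ OnC (embed p) →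
                            Σ K λ y → Proportional (embed p) (embed (linePoint y))
      linePoints-complete p@(x , y , z) p∈L p∉C with z 𝔽.≟ 0#
      ... | yes z≡0 =
        ⊥-elim (p∉C (≡.subst₂ (λ x z → OnC (embed (x , y , z))) (sym x≡0) (sym z≡0) (form-Y (ι y))))
        where
        x≡0 : x ≡ 0#
        x≡0 = 𝔽.*≡0⇒≡0 b₁≢0 (begin
          b₁ * x                     ≡⟨ 𝔽.solve 4 (λ b₁ d₁ x y →
              b₁ :* x := b₁ :* x :+ 0ᴾ :* y :+ d₁ :* 0ᴾ) refl b₁ d₁ x y ⟩
          b₁ * x + 0# * y + d₁ * 0#  ≡⟨ cong (λ z → b₁ * x + 0# * y + d₁ * z) z≡0 ⟨
          L₀ ℙ.∙ p                   ≡⟨ ι-injective (trans (sym (embed-∙ L₀ p)) p∈L) ⟩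
          0#                         ∎)
          where open 𝔽 using (_:=_; _:+_; _:*_; 0ᴾ)
      ... | no z≢0 =
        y′ , ι t , (λ ιt≡0 → t≢0 (ι-injective ιt≡0)) , trans (cong embed p≡) (embed-scale t (linePoint y′))
        where
        multiple : Σ K λ y′ → Σ K λ t → t ≢ 0# × p ≡ ℙ.scale t (linePoint y′)
        multiple = ℙ.on-line-through-e₂ {b₁} {d₁} {p} b₁≢0
                     (ι-injective (trans (sym (embed-∙ L₀ p)) p∈L)) z≢0
        y′ t : K
        y′ = proj₁ multiple
        t = proj₁ (proj₂ multiple)
        t≢0 : t ≢ 0#
        t≢0 = proj₁ (proj₂ (proj₂ multiple))
        p≡ : p ≡ ℙ.scale t (linePoint y′)
        p≡ = proj₂ (proj₂ (proj₂ multiple))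

      linePoints-cover : ∀ p → OnLine (embed L₀) (embed p) → ¬ OnC (embed p) →
                         Any (λ y → Proportional (embed p) (embed (linePoint y))) elements
      linePoints-cover p p∈L p∉C =
        Any.map (λ y≡y′ → ≡.subst (λ y → Proportional (embed p) (embed (linePoint y))) y≡y′ (proj₂ y∝))
                (complete (proj₁ y∝))
        where
        y∝ : Σ K λ y → Proportional (embed p) (embed (linePoint y))
        y∝ = linePoints-complete p p∈L p∉C

lemma6p1 : (F : FiniteOddField) → let open FiniteOddField F in
    (ω : K) → NonSquare ω →
    let open Ext F ω in
    (a b c d e : K₂) → let open Conic a b c d e in
    Irreducible →
    ¬ (b ≡ 0₂) →
    (¬ (proj₂ b ≡ 0#) ⊎ ¬ (proj₂ d ≡ 0#)) →
    proj₁ b * proj₂ d ≡ proj₁ d * proj₂ b →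
    ¬ (proj₁ b ≡ 0# × proj₁ d ≡ 0#) →
    let L = (ι (proj₁ b) , 0₂ , ι (proj₁ d)) in
    TangentAt L (0₂ , 1₂ , 0₂)
    × Σ (List (K × K × K)) (λ ps →
        length ps ≡ q
        × All (λ p → NonZero (embed p) × OnLine L (embed p) × External (embed p)) ps
        × AllPairs (λ p p′ → ¬ Proportional (embed p) (embed p′)) ps
        × (∀ p → NonZero (embed p) → OnLine L (embed p) → External (embed p) →
             Any (λ p′ → Proportional (embed p) (embed p′)) ps))
lemma6p1 F ω nonSquare a b c d e irreducible b≢0 _ b₁d₂≡d₁b₂ b₁,d₁≢0 =
  tangentAt-L , map linePoint elements , length-map linePoint elements ,
  All.map⁺ (All.universal (λ y → proj₁ (linePoint-external y) , linePoint-on-L y , linePoint-external y)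
                          elements) ,
  AllPairs.map⁺ (AllPairs.map linePoints-distinct unique) ,
  λ p _ p∈L p-external → Any.map⁺ (linePoints-cover p p∈L (proj₁ (proj₂ p-external)))
  where
  open FiniteOddField F using (elements; unique)
  open ConicOverQuadraticExtension F ω nonSquare a b c d e
  open RationalTangent irreducible b≢0 b₁d₂≡d₁b₂ b₁,d₁≢0
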